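{- Let $G$ be a connected graph with target-independent cost function $c\colon V(G)\to\mathbb{N}$ and weight function $w\colon V(G)\to\mathbb{N}$, let $D^*$ be a decision tree of minimum cost $\mathrm{OPT}(G)=c_G(D^*)$, and for each integer $k\ge 0$ let $S_k^*$ be as defined in the context. Then $$\mathrm{OPT}(G)=\sum_{k=0}^{w(G)-1}c(S_k^*).$$
   Context: A decision tree for a connected graph $G$ is a rooted tree $D$ whose root is some $r\in V(G)$ and whose subtrees hanging from the root are, one for each connected component $H$ of $G-r$, decision trees for $H$; every vertex of $G$ is a node of $D$ exactly once. $Q_G(D,x)$ is the sequence of nodes on the path in $D$ from the root to $x$, $c_G(D,x)=\sum_{q\in Q_G(D,x)}c(q)$, $c_G(D)=\sum_{x}w(x)c_G(D,x)$. For $S\subseteq V$, $f(S)=\sum_{v\in S}f(v)$. For $v\in V(G)$, $G_{D,v}$ is the subgraph induced by the vertices of the subtree of $D$ rooted at $v$; $\mathcal{R}_{D}(G)=\{V(G_{D,v})\colon v\in V(G)\}$. For an integer $k$, $\mathcal{L}_k^*$ is the family of all maximal (under inclusion) elements $H\in\mathcal{R}_{D^*}(G)$ with $w(H)\le k$, and $S_k^*=V(G)\setminus\bigcup_{H\in\mathcal{L}_k^*}H$. -}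

module Defs where

open import Data.Nat using (ℕ; zero; suc; _+_; _*_; _≤_; _≤?_)
open import Data.Bool using (Bool; true; false; if_then_else_)
import Data.Bool.Properties as BoolP
open import Data.Fin using (Fin)
import Data.Fin.Properties as FinP
open import Data.Fin.Subset
  using (Subset; _∈_; _∉_; _⊆_; _∩_; ⋃; _-_; ⁅_⁆; _∪_; ∁; ⊤; Nonempty; Empty)
open import Data.Fin.Subset.Properties using (_∈?_; _⊆?_)
open import Data.List using (List; []; _∷_; map; concat; concatMap; allFin; filter; upTo)
open import Data.Nat.ListAction using (sum)
open import Data.List.Relation.Unary.All using (All)
import Data.List.Relation.Unary.All as All
open import Data.List.Relation.Unary.AllPairs using (AllPairs)
import Data.Vec.Properties as VecP
open import Data.Product using (_×_; Σ; _,_)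
open import Relation.Binary.PropositionalEquality using (_≡_)
open import Relation.Nullary using (Dec; yes; no; does; ¬_)
open import Relation.Nullary.Decidable using (_×-dec_; _→-dec_)

record Graph (n : ℕ) : Set where
  field
    adj    : Fin n → Fin n → Bool
    sym    : ∀ u v → adj u v ≡ adj v u
    irrefl : ∀ v → adj v v ≡ false

module _ {n : ℕ} (G : Graph n) where
  open Graph G

  -- Paths that stay inside the vertex set X (all vertices after the first lie in X).
  data PathIn (X : Subset n) : Fin n → Fin n → Set where
    here : ∀ {u} → PathIn X u u
    step : ∀ {u v w} → adj u v ≡ true → v ∈ X → PathIn X v w → PathIn X u w

  ConnectedSet : Subset n → Set
  ConnectedSet X = ∀ u v → u ∈ X → v ∈ X → PathIn X u v

  Connected : Set
  Connected = ConnectedSet ⊤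

  -- H is (the vertex set of) a connected component of G[Y]:
  -- a nonempty connected subset of Y that is closed under adjacency inside Y
  -- (i.e. a maximal connected subset of Y).
  IsComponent : Subset n → Subset n → Set
  IsComponent Y H =
    H ⊆ Y × Nonempty H × ConnectedSet H ×
    (∀ u v → u ∈ H → v ∈ Y → adj u v ≡ true → v ∈ H)

data DTree (n : ℕ) : Set where
  node : Fin n → List (DTree n) → DTree n

module _ {n : ℕ} where

  mutual
    verts : DTree n → Subset n
    verts (node r ts) = ⁅ r ⁆ ∪ vertsList ts

    vertsList : List (DTree n) → Subset n
    vertsList []       = Data.Fin.Subset.⊥
    vertsList (t ∷ ts) = verts t ∪ vertsList ts

  mutual
    subtrees : DTree n → List (DTree n)
    subtrees (node r ts) = node r ts ∷ subtreesList ts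

    subtreesList : List (DTree n) → List (DTree n)
    subtreesList []       = []
    subtreesList (t ∷ ts) = subtrees t Data.List.++ subtreesList ts

  mutual
    pathTo : DTree n → Fin n → List (Fin n)
    pathTo (node r ts) x with does (FinP._≟_ x r)
    ... | true  = r ∷ []
    ... | false = r ∷ pathToList ts x

    pathToList : List (DTree n) → Fin n → List (Fin n)
    pathToList []       x = []
    pathToList (t ∷ ts) x with does (x ∈? verts t)
    ... | true  = pathTo t x
    ... | false = pathToList ts x

  sumSet : (Fin n → ℕ) → Subset n → ℕ
  sumSet f S = sum (map (λ v → if does (v ∈? S) then f v else 0) (allFin n))

module _ {n : ℕ} (G : Graph n) where

  data IsDecisionTree : Subset n → DTree n → Set where
    mk : ∀ {X r ts} →
         r ∈ X →
         All (λ t → IsComponent G (X - r) (verts t) × IsDecisionTree (verts t) t) ts →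
         AllPairs (λ A B → Empty (A ∩ B)) (map verts ts) →
         vertsList ts ≡ X - r →
         IsDecisionTree X (node r ts)

  IsDecisionTreeG : DTree n → Set
  IsDecisionTreeG = IsDecisionTree ⊤

  module _ (c w : Fin n → ℕ) where

    costAt : DTree n → Fin n → ℕ
    costAt D x = sum (map c (pathTo D x))

    cost : DTree n → ℕ
    cost D = sum (map (λ x → w x * costAt D x) (allFin n))

    IsOptimal : DTree n → Set
    IsOptimal D = IsDecisionTreeG D × (∀ D' → IsDecisionTreeG D' → cost D ≤ cost D')

    R : DTree n → List (Subset n)
    R D = map verts (subtrees D)

    private
      _≟S_ : (A B : Subset n) → Dec (A ≡ B)
      _≟S_ = VecP.≡-dec BoolP._≟_

    maximal? : (D : DTree n) (k : ℕ) (H : Subset n) →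
               Dec (sumSet w H ≤ k ×
                    All (λ H' → sumSet w H' ≤ k → H ⊆ H' → H' ≡ H) (R D))
    maximal? D k H =
      (sumSet w H ≤? k) ×-dec
      All.all? (λ H' → (sumSet w H' ≤? k) →-dec ((H ⊆? H') →-dec (H' ≟S H))) (R D)

    L : DTree n → ℕ → List (Subset n)
    L D k = filter (maximal? D k) (R D)

    S : DTree n → ℕ → Subset n
    S D k = ∁ (⋃ (L D k))

{-# OPTIONS --safe #-}
-- Write c_v for the cost of v and w_v for the weight of G_{D,v}. The path from the root to x
-- passes through exactly those v whose subtree contains x, so exchanging the two sums gives
-- c_G(D) = Σ_v c_v w_v. The subtrees of D form a laminar family, so v is covered by a maximal
-- subtree of weight at most k iff w_v ≤ k. Hence v ∈ S_k for exactly the w_v values k < w_v, all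
-- below w(G), and Σ_k c(S_k) = Σ_v c_v w_v as well.
module Submission where

open import Defs
open import Data.Nat using (ℕ)
open import Data.Fin using (Fin)
open import Data.Fin.Subset using (⊤)
open import Data.List using (map; upTo)
open import Data.Nat.ListAction using (sum)
open import Relation.Binary.PropositionalEquality using (_≡_)

open import Data.Nat using (zero; suc; _+_; _*_; _⊓_; _≤_; _<_; _≤?_; _<?_; z≤n)
open import Data.Nat.Properties
  using ( ≤-refl; ≤-trans; <⇒≤; <⇒≱; ≰⇒>; ≮⇒≥; n≤1+n; +-comm; +-identityʳ
        ; *-comm; *-suc; *-zeroʳ; *-distribˡ-+; +-mono-≤; m≤n⇒m⊓n≡m; m≥n⇒m⊓n≡n
        ; +-commutativeSemigroup)
open import Algebra.Properties.CommutativeSemigroup +-commutativeSemigroup using (interchange)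
open import Data.Nat.ListAction.Properties using (sum-++)
open import Data.Bool using (Bool; true; false; if_then_else_)
open import Data.Fin using (zero; suc)
import Data.Fin.Properties as FinP
open import Data.Fin.Subset
  using (Subset; _∈_; _∉_; _⊆_; _∪_; _∩_; _─_; ⋃; ⁅_⁆; ∣_∣; Empty; inside; outside)
  renaming (⊥ to ∅)
open import Data.Fin.Subset.Properties
  using ( _∈?_; ∉⊥; ∈⊤; x∈⁅x⁆; x∈⁅y⁆⇒x≡y; x∈p∪q⁻; x∈p∪q⁺; x∈p∩q⁺; x∈∁p⇒x∉p; x∉p⇒x∈∁p
        ; ⊆-antisym; p⊂q⇒∣p∣<∣q∣; x∈p∧x≢y⇒x∈p-y)
open import Data.List using (List; []; _∷_; _++_; [_]; filter; allFin; tabulate)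
import Data.List.Properties as LP
open import Data.List.Membership.Propositional using () renaming (_∈_ to _∈L_)
import Data.List.Membership.Propositional.Properties as LMP
open import Data.List.Relation.Unary.Any using (here; there)
open import Data.List.Relation.Unary.All using (All; []; _∷_)
import Data.List.Relation.Unary.All as All
open import Data.List.Relation.Unary.AllPairs using (AllPairs; []; _∷_)
open import Data.List.Extrema.Nat using (argmax; argmax-all; f[xs]≤f[argmax])
import Data.Vec.Base as Vec
open import Data.Product using (_×_; _,_; proj₁; proj₂; ∃-syntax)
open import Data.Sum using (inj₁; inj₂; [_,_]′)
open import Data.Empty using (⊥-elim)
open import Data.Unit using (tt) renaming (⊤ to Unit)
open import Function using (id; _∘_; _⇔_; mk⇔; module Equivalence)
open import Relation.Binary.PropositionalEquality
  using (refl; sym; trans; cong; cong₂; subst; _≢_; module ≡-Reasoning)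
open import Relation.Nullary using (Dec; yes; no; does; ¬_)
open import Relation.Nullary.Decidable using (dec-true; dec-false; does-⇔; _×-dec_)
open import Relation.Unary using (Decidable)

open ≡-Reasoning

infixl 5 _when_

_when_ : ℕ → Bool → ℕ
a when b = if b then a else 0

when-yes : ∀ {P : Set} (P? : Dec P) {a} → P → a when does P? ≡ a
when-yes P? {a} p = cong (a when_) (dec-true P? p)

when-no : ∀ {P : Set} (P? : Dec P) {a} → ¬ P → a when does P? ≡ 0
when-no P? {a} ¬p = cong (a when_) (dec-false P? ¬p)

*-when-comm : ∀ a b β → a * (b when β) ≡ b * (a when β)
*-when-comm a b true  = *-comm a b
*-when-comm a b false = trans (*-zeroʳ a) (sym (*-zeroʳ b))

module _ {A : Set} where

  sum-map-cong : ∀ (xs : List A) {f g : A → ℕ} → (∀ {x} → x ∈L xs → f x ≡ g x) →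
                 sum (map f xs) ≡ sum (map g xs)
  sum-map-cong []       f≗g = refl
  sum-map-cong (x ∷ xs) f≗g = cong₂ _+_ (f≗g (here refl)) (sum-map-cong xs (f≗g ∘ there))

  sum-map-≡0 : ∀ (xs : List A) {f : A → ℕ} → (∀ {x} → x ∈L xs → f x ≡ 0) → sum (map f xs) ≡ 0
  sum-map-≡0 []       f≗0 = refl
  sum-map-≡0 (x ∷ xs) f≗0 = cong₂ _+_ (f≗0 (here refl)) (sum-map-≡0 xs (f≗0 ∘ there))

  sum-map-++ : ∀ (f : A → ℕ) xs ys → sum (map f (xs ++ ys)) ≡ sum (map f xs) + sum (map f ys)
  sum-map-++ f xs ys = trans (cong sum (LP.map-++ f xs ys)) (sum-++ (map f xs) (map f ys))

  sum-map-+ : ∀ (xs : List A) (f g : A → ℕ) →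
              sum (map (λ x → f x + g x) xs) ≡ sum (map f xs) + sum (map g xs)
  sum-map-+ []       f g = refl
  sum-map-+ (x ∷ xs) f g =
    trans (cong (f x + g x +_) (sum-map-+ xs f g)) (interchange (f x) (g x) _ _)

  sum-map-*ˡ : ∀ (xs : List A) (k : ℕ) (f : A → ℕ) →
               sum (map (λ x → k * f x) xs) ≡ k * sum (map f xs)
  sum-map-*ˡ []       k f = sym (*-zeroʳ k)
  sum-map-*ˡ (x ∷ xs) k f =
    trans (cong (k * f x +_) (sum-map-*ˡ xs k f)) (sym (*-distribˡ-+ k (f x) _))

  sum-map-mono : ∀ (xs : List A) {f g : A → ℕ} → (∀ x → f x ≤ g x) →
                 sum (map f xs) ≤ sum (map g xs)
  sum-map-mono []       f≤g = z≤n
  sum-map-mono (x ∷ xs) f≤g = +-mono-≤ (f≤g x) (sum-map-mono xs f≤g)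

sum-map-comm : ∀ {A B : Set} (xs : List A) (ys : List B) (F : A → B → ℕ) →
               sum (map (λ a → sum (map (F a) ys)) xs) ≡
               sum (map (λ b → sum (map (λ a → F a b) xs)) ys)
sum-map-comm []       ys F = sym (sum-map-≡0 ys (λ _ → refl))
sum-map-comm (a ∷ xs) ys F =
  trans (cong (sum (map (F a) ys) +_) (sum-map-comm xs ys F))
        (sym (sum-map-+ ys (F a) (λ b → sum (map (λ a′ → F a′ b) xs))))

sum-upTo-when-< : ∀ a m W → sum (map (λ k → a when does (k <? m)) (upTo W)) ≡ a * (W ⊓ m)
sum-upTo-when-< a m zero    = sym (*-zeroʳ a)
sum-upTo-when-< a m (suc W) = begin
  sum (map g (upTo (suc W)))           ≡⟨ cong (sum ∘ map g) (sym (LP.upTo-∷ʳ W)) ⟩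
  sum (map g (upTo W ++ [ W ]))        ≡⟨ sum-map-++ g (upTo W) [ W ] ⟩
  sum (map g (upTo W)) + (g W + 0)     ≡⟨ cong₂ _+_ (sum-upTo-when-< a m W) (+-identityʳ (g W)) ⟩
  a * (W ⊓ m) + g W                    ≡⟨ last-term ⟩
  a * (suc W ⊓ m)                      ∎
  where
  g : ℕ → ℕ
  g k = a when does (k <? m)

  last-term : a * (W ⊓ m) + g W ≡ a * (suc W ⊓ m)
  last-term with W <? m
  ... | yes W<m = begin
    a * (W ⊓ m) + g W ≡⟨ cong (a * (W ⊓ m) +_) (when-yes (W <? m) W<m) ⟩
    a * (W ⊓ m) + a   ≡⟨ cong (λ i → a * i + a) (m≤n⇒m⊓n≡m (<⇒≤ W<m)) ⟩
    a * W + a         ≡⟨ +-comm (a * W) a ⟩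
    a + a * W         ≡⟨ *-suc a W ⟨
    a * suc W         ≡⟨ cong (a *_) (m≤n⇒m⊓n≡m W<m) ⟨
    a * (suc W ⊓ m)   ∎
  ... | no W≮m = begin
    a * (W ⊓ m) + g W ≡⟨ cong (a * (W ⊓ m) +_) (when-no (W <? m) W≮m) ⟩
    a * (W ⊓ m) + 0   ≡⟨ +-identityʳ _ ⟩
    a * (W ⊓ m)       ≡⟨ cong (a *_) (m≥n⇒m⊓n≡n (≮⇒≥ W≮m)) ⟩
    a * m             ≡⟨ cong (a *_) (m≥n⇒m⊓n≡n (≤-trans (≮⇒≥ W≮m) (n≤1+n W))) ⟨
    a * (suc W ⊓ m)   ∎

sum-tabulate-≡0 : ∀ {n} (g : Fin n → ℕ) → (∀ x → g x ≡ 0) → sum (tabulate g) ≡ 0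
sum-tabulate-≡0 {zero}  g g≗0 = refl
sum-tabulate-≡0 {suc n} g g≗0 = cong₂ _+_ (g≗0 zero) (sum-tabulate-≡0 (g ∘ suc) (g≗0 ∘ suc))

sum-tabulate-single : ∀ {n} (r : Fin n) (g : Fin n → ℕ) → (∀ x → x ≢ r → g x ≡ 0) →
                      sum (tabulate g) ≡ g r
sum-tabulate-single {suc n} zero    g g≗0 =
  trans (cong (g zero +_) (sum-tabulate-≡0 (g ∘ suc) (λ x → g≗0 (suc x) λ ())))
        (+-identityʳ (g zero))
sum-tabulate-single {suc n} (suc r) g g≗0 =
  cong₂ _+_ (g≗0 zero λ ())
            (sum-tabulate-single r (g ∘ suc) (λ x x≢r → g≗0 (suc x) (x≢r ∘ FinP.suc-injective)))

x∈p─q⇒x∉q : ∀ {n} (p q : Subset n) {x} → x ∈ p ─ q → x ∉ q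
x∈p─q⇒x∉q (_ Vec.∷ p) (inside  Vec.∷ q) {zero}  ()
x∈p─q⇒x∉q (_ Vec.∷ p) (outside Vec.∷ q) {zero}  _ = λ ()
x∈p─q⇒x∉q (_ Vec.∷ p) (_       Vec.∷ q) {suc x} (Vec.there x∈p─q) (Vec.there x∈q) =
  x∈p─q⇒x∉q p q x∈p─q x∈q

module _ {n : ℕ} where

  Disjoint : Subset n → Subset n → Set
  Disjoint A B = ∀ {x} → x ∈ A → ¬ x ∈ B

  ∈-∪-resolveʳ : ∀ {A B : Subset n} {x} → x ∈ A ∪ B → x ∉ A → x ∈ B
  ∈-∪-resolveʳ {A} {B} x∈A∪B x∉A = [ ⊥-elim ∘ x∉A , id ]′ (x∈p∪q⁻ A B x∈A∪B)

  p⊆q∧∣q∣≤∣p∣⇒q≡p : ∀ {p q : Subset n} → p ⊆ q → ∣ q ∣ ≤ ∣ p ∣ → q ≡ p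
  p⊆q∧∣q∣≤∣p∣⇒q≡p {p} {q} p⊆q ∣q∣≤∣p∣ = sym (⊆-antisym p⊆q q⊆p)
    where
    q⊆p : q ⊆ p
    q⊆p {x} x∈q with x ∈? p
    ... | yes x∈p = x∈p
    ... | no  x∉p = ⊥-elim (<⇒≱ (p⊂q⇒∣p∣<∣q∣ (p⊆q , x , x∈q , x∉p)) ∣q∣≤∣p∣)

  x∈⋃⁺ : ∀ (Hs : List (Subset n)) {H x} → H ∈L Hs → x ∈ H → x ∈ ⋃ Hs
  x∈⋃⁺ (_ ∷ Hs) (here refl) x∈H = x∈p∪q⁺ (inj₁ x∈H)
  x∈⋃⁺ (_ ∷ Hs) (there H∈) x∈H = x∈p∪q⁺ (inj₂ (x∈⋃⁺ Hs H∈ x∈H))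

  x∈⋃⁻ : ∀ (Hs : List (Subset n)) {x} → x ∈ ⋃ Hs → ∃[ H ] H ∈L Hs × x ∈ H
  x∈⋃⁻ []       x∈⋃ = ⊥-elim (∉⊥ x∈⋃)
  x∈⋃⁻ (H ∷ Hs) x∈⋃ with x∈p∪q⁻ H (⋃ Hs) x∈⋃
  ... | inj₁ x∈H  = H , here refl , x∈H
  ... | inj₂ x∈⋃′ with x∈⋃⁻ Hs x∈⋃′
  ...   | H′ , H′∈ , x∈H′ = H′ , there H′∈ , x∈H′

  -- A largest-cardinality set among the candidates is maximal under inclusion.
  ∃-maximal : ∀ {P : Subset n → Set} → Decidable P → ∀ (Hs : List (Subset n)) {H₀} →
              H₀ ∈L Hs → P H₀ →
              ∃[ M ] M ∈L Hs × P M × (∀ {H} → H ∈L Hs → P H → M ⊆ H → H ≡ M)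
  ∃-maximal {P} P? Hs {H₀} H₀∈Hs PH₀ = M , proj₁ M∈Hs×PM , proj₂ M∈Hs×PM , maximal
    where
    M : Subset n
    M = argmax ∣_∣ H₀ (filter P? Hs)

    M∈Hs×PM : M ∈L Hs × P M
    M∈Hs×PM = argmax-all ∣_∣ (H₀∈Hs , PH₀) (All.tabulate (LMP.∈-filter⁻ P?))

    maximal : ∀ {H} → H ∈L Hs → P H → M ⊆ H → H ≡ M
    maximal H∈Hs PH M⊆H = p⊆q∧∣q∣≤∣p∣⇒q≡p M⊆H
      (All.lookup (f[xs]≤f[argmax] H₀ (filter P? Hs)) (LMP.∈-filter⁺ P? H∈Hs PH))

  infixl 6 _↾_

  -- sumSet f S is definitionally sum (map (f ↾ S) (allFin n)).
  _↾_ : (Fin n → ℕ) → Subset n → Fin n → ℕ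
  (f ↾ S) x = f x when does (x ∈? S)

  ↾-∈ : ∀ (f : Fin n → ℕ) {S x} → x ∈ S → (f ↾ S) x ≡ f x
  ↾-∈ f {S} {x} = when-yes (x ∈? S)

  ↾-∉ : ∀ (f : Fin n → ℕ) {S x} → x ∉ S → (f ↾ S) x ≡ 0
  ↾-∉ f {S} {x} = when-no (x ∈? S)

  ↾-∪ : ∀ (f : Fin n → ℕ) {A B} → Disjoint A B → ∀ x → (f ↾ (A ∪ B)) x ≡ (f ↾ A) x + (f ↾ B) x
  ↾-∪ f {A} {B} A∩B=∅ x with x ∈? A | x ∈? B
  ... | yes x∈A | yes x∈B = ⊥-elim (A∩B=∅ x∈A x∈B)
  ... | yes x∈A | no  _   = trans (↾-∈ f (x∈p∪q⁺ (inj₁ x∈A))) (sym (+-identityʳ (f x)))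
  ... | no  _   | yes x∈B = ↾-∈ f (x∈p∪q⁺ (inj₂ x∈B))
  ... | no  x∉A | no  x∉B = ↾-∉ f ([ x∉A , x∉B ]′ ∘ x∈p∪q⁻ A B)

  sumSet-⊥ : ∀ (f : Fin n → ℕ) → sumSet f ∅ ≡ 0
  sumSet-⊥ f = sum-map-≡0 (allFin n) (λ _ → ↾-∉ f ∉⊥)

  sumSet-⁅⁆ : ∀ (f : Fin n → ℕ) r → sumSet f ⁅ r ⁆ ≡ f r
  sumSet-⁅⁆ f r = begin
    sum (map (f ↾ ⁅ r ⁆) (allFin n))  ≡⟨ cong sum (LP.map-tabulate id (f ↾ ⁅ r ⁆)) ⟩
    sum (tabulate (f ↾ ⁅ r ⁆))        ≡⟨ sum-tabulate-single r (f ↾ ⁅ r ⁆) off-r ⟩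
    (f ↾ ⁅ r ⁆) r                     ≡⟨ ↾-∈ f (x∈⁅x⁆ r) ⟩
    f r                               ∎
    where
    off-r : ∀ x → x ≢ r → (f ↾ ⁅ r ⁆) x ≡ 0
    off-r x x≢r = ↾-∉ f (x≢r ∘ x∈⁅y⁆⇒x≡y r)

  sumSet-∪ : ∀ (f : Fin n → ℕ) {A B} → Disjoint A B → sumSet f (A ∪ B) ≡ sumSet f A + sumSet f B
  sumSet-∪ f {A} {B} A∩B=∅ =
    trans (sum-map-cong (allFin n) (λ {x} _ → ↾-∪ f A∩B=∅ x)) (sum-map-+ (allFin n) (f ↾ A) (f ↾ B))

  sumSet-mono : ∀ (f : Fin n → ℕ) {A B} → A ⊆ B → sumSet f A ≤ sumSet f B
  sumSet-mono f {A} {B} A⊆B = sum-map-mono (allFin n) pointwise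
    where
    pointwise : ∀ x → (f ↾ A) x ≤ (f ↾ B) x
    pointwise x with x ∈? A | x ∈? B
    ... | yes _   | yes _   = ≤-refl
    ... | yes x∈A | no  x∉B = ⊥-elim (x∉B (A⊆B x∈A))
    ... | no  _   | _       = z≤n

  sumSet-full : ∀ (f : Fin n → ℕ) {S} → (∀ x → x ∈ S) → sumSet f S ≡ sum (map f (allFin n))
  sumSet-full f full = sum-map-cong (allFin n) (λ {x} _ → ↾-∈ f (full x))

root : ∀ {n} → DTree n → Fin n
root (node r _) = r

module _ {n : ℕ} where

  mutual
    UniqueLabels : DTree n → Set
    UniqueLabels (node r ts) = r ∉ vertsList ts × UniqueLabelsForest ts

    UniqueLabelsForest : List (DTree n) → Set
    UniqueLabelsForest []       = Unit
    UniqueLabelsForest (t ∷ ts) =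
      UniqueLabels t × Disjoint (verts t) (vertsList ts) × UniqueLabelsForest ts

  root∈verts : ∀ (t : DTree n) → root t ∈ verts t
  root∈verts (node r ts) = x∈p∪q⁺ (inj₁ (x∈⁅x⁆ r))

  mutual
    verts-subtree-⊆ : ∀ t {s : DTree n} → s ∈L subtrees t → verts s ⊆ verts t
    verts-subtree-⊆ (node r ts) (here refl) x∈s = x∈s
    verts-subtree-⊆ (node r ts) (there s∈) x∈s = x∈p∪q⁺ (inj₂ (vertsList-subtree-⊆ ts s∈ x∈s))

    vertsList-subtree-⊆ : ∀ ts {s : DTree n} → s ∈L subtreesList ts → verts s ⊆ vertsList ts
    vertsList-subtree-⊆ (t ∷ ts) s∈ x∈s with LMP.∈-++⁻ (subtrees t) s∈
    ... | inj₁ s∈t  = x∈p∪q⁺ (inj₁ (verts-subtree-⊆ t s∈t x∈s))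
    ... | inj₂ s∈ts = x∈p∪q⁺ (inj₂ (vertsList-subtree-⊆ ts s∈ts x∈s))

  mutual
    subtrees-laminar : ∀ t → UniqueLabels t → ∀ {s s′} → s ∈L subtrees t → s′ ∈L subtrees t →
                       root s ∈ verts s′ → verts s ⊆ verts s′
    subtrees-laminar (node r ts) _          (here refl) (here refl) _ x∈s = x∈s
    subtrees-laminar (node r ts) (r∉ts , _) (here refl) (there s′∈) r∈s′ _ =
      ⊥-elim (r∉ts (vertsList-subtree-⊆ ts s′∈ r∈s′))
    subtrees-laminar (node r ts) _          (there s∈) (here refl) _ =
      verts-subtree-⊆ (node r ts) (there s∈)
    subtrees-laminar (node r ts) (_ , uts)  (there s∈) (there s′∈) =
      subtrees-laminar-forest ts uts s∈ s′∈

    subtrees-laminar-forest : ∀ ts → UniqueLabelsForest ts → ∀ {s s′} →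
                              s ∈L subtreesList ts → s′ ∈L subtreesList ts →
                              root s ∈ verts s′ → verts s ⊆ verts s′
    subtrees-laminar-forest (t ∷ ts) (ut , t∩ts=∅ , uts) {s} {s′} s∈ s′∈ rs∈s′
      with LMP.∈-++⁻ (subtrees t) s∈ | LMP.∈-++⁻ (subtrees t) s′∈
    ... | inj₁ s∈t  | inj₁ s′∈t  = subtrees-laminar t ut s∈t s′∈t rs∈s′
    ... | inj₂ s∈ts | inj₂ s′∈ts = subtrees-laminar-forest ts uts s∈ts s′∈ts rs∈s′
    ... | inj₁ s∈t  | inj₂ s′∈ts =
      ⊥-elim (t∩ts=∅ (verts-subtree-⊆ t s∈t (root∈verts s)) (vertsList-subtree-⊆ ts s′∈ts rs∈s′))
    ... | inj₂ s∈ts | inj₁ s′∈t  =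
      ⊥-elim (t∩ts=∅ (verts-subtree-⊆ t s′∈t rs∈s′) (vertsList-subtree-⊆ ts s∈ts (root∈verts s)))

  mutual
    sum-map-root : ∀ t → UniqueLabels t → ∀ (f : Fin n → ℕ) →
                   sum (map (f ∘ root) (subtrees t)) ≡ sumSet f (verts t)
    sum-map-root (node r ts) (r∉ts , uts) f = begin
      f r + sum (map (f ∘ root) (subtreesList ts))
        ≡⟨ cong₂ _+_ (sym (sumSet-⁅⁆ f r)) (sum-map-root-forest ts uts f) ⟩
      sumSet f ⁅ r ⁆ + sumSet f (vertsList ts)
        ≡⟨ sumSet-∪ f r∩ts=∅ ⟨
      sumSet f (⁅ r ⁆ ∪ vertsList ts) ∎
      where
      r∩ts=∅ : Disjoint ⁅ r ⁆ (vertsList ts)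
      r∩ts=∅ x∈r x∈ts with x∈⁅y⁆⇒x≡y r x∈r
      ... | refl = r∉ts x∈ts

    sum-map-root-forest : ∀ ts → UniqueLabelsForest ts → ∀ (f : Fin n → ℕ) →
                          sum (map (f ∘ root) (subtreesList ts)) ≡ sumSet f (vertsList ts)
    sum-map-root-forest []       _                     f = sym (sumSet-⊥ f)
    sum-map-root-forest (t ∷ ts) (ut , t∩ts=∅ , uts) f = begin
      sum (map (f ∘ root) (subtrees t ++ subtreesList ts))
        ≡⟨ sum-map-++ (f ∘ root) (subtrees t) (subtreesList ts) ⟩
      sum (map (f ∘ root) (subtrees t)) + sum (map (f ∘ root) (subtreesList ts))
        ≡⟨ cong₂ _+_ (sum-map-root t ut f) (sum-map-root-forest ts uts f) ⟩
      sumSet f (verts t) + sumSet f (vertsList ts)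
        ≡⟨ sumSet-∪ f t∩ts=∅ ⟨
      sumSet f (verts t ∪ vertsList ts) ∎

  module _ (c : Fin n → ℕ) (x : Fin n) where

    rootCostContaining : List (DTree n) → ℕ
    rootCostContaining ss = sum (map (λ s → c (root s) when does (x ∈? verts s)) ss)

    rootCostContaining-∉ : ∀ ss {V} → (∀ {s} → s ∈L ss → verts s ⊆ V) → x ∉ V →
                           rootCostContaining ss ≡ 0
    rootCostContaining-∉ ss ss⊆V x∉V =
      sum-map-≡0 ss (λ s∈ → when-no (x ∈? _) (x∉V ∘ ss⊆V s∈))

    mutual
      sum-pathTo : ∀ t → UniqueLabels t → x ∈ verts t →
                   sum (map c (pathTo t x)) ≡ rootCostContaining (subtrees t)
      sum-pathTo (node r ts) (r∉ts , uts) x∈t with x FinP.≟ r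
      ... | yes refl = cong₂ _+_ (sym (when-yes (x ∈? _) x∈t))
                                 (sym (rootCostContaining-∉ _ (vertsList-subtree-⊆ ts) r∉ts))
      ... | no  x≢r  = cong₂ _+_ (sym (when-yes (x ∈? _) x∈t))
                                 (sum-pathToList ts uts (∈-∪-resolveʳ x∈t (x≢r ∘ x∈⁅y⁆⇒x≡y r)))

      sum-pathToList : ∀ ts → UniqueLabelsForest ts → x ∈ vertsList ts →
                       sum (map c (pathToList ts x)) ≡ rootCostContaining (subtreesList ts)
      sum-pathToList []       _                     x∈⊥ = ⊥-elim (∉⊥ x∈⊥)
      sum-pathToList (t ∷ ts) (ut , t∩ts=∅ , uts) x∈ with x ∈? verts t
      ... | yes x∈t = begin
        sum (map c (pathTo t x))
          ≡⟨ sum-pathTo t ut x∈t ⟩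
        rootCostContaining (subtrees t)
          ≡⟨ +-identityʳ _ ⟨
        rootCostContaining (subtrees t) + 0
          ≡⟨ cong (_ +_) (rootCostContaining-∉ _ (vertsList-subtree-⊆ ts) (t∩ts=∅ x∈t)) ⟨
        rootCostContaining (subtrees t) + rootCostContaining (subtreesList ts)
          ≡⟨ sum-map-++ _ (subtrees t) (subtreesList ts) ⟨
        rootCostContaining (subtrees t ++ subtreesList ts) ∎
      ... | no  x∉t = begin
        sum (map c (pathToList ts x))
          ≡⟨ sum-pathToList ts uts (∈-∪-resolveʳ x∈ x∉t) ⟩
        rootCostContaining (subtreesList ts)
          ≡⟨ cong (_+ _) (rootCostContaining-∉ (subtrees t) (verts-subtree-⊆ t) x∉t) ⟨
        rootCostContaining (subtrees t) + rootCostContaining (subtreesList ts)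
          ≡⟨ sum-map-++ _ (subtrees t) (subtreesList ts) ⟨
        rootCostContaining (subtrees t ++ subtreesList ts) ∎

  mutual
    IsDecisionTree⇒UniqueLabels : ∀ {G : Graph n} {X t} → IsDecisionTree G X t → UniqueLabels t
    IsDecisionTree⇒UniqueLabels (mk {X = X} {r = r} _ children disjoint vertsList≡X-r) =
      (λ r∈ts → x∈p─q⇒x∉q X ⁅ r ⁆ (subst (r ∈_) vertsList≡X-r r∈ts) (x∈⁅x⁆ r)) ,
      IsDecisionTree⇒UniqueLabelsForest children disjoint

    IsDecisionTree⇒UniqueLabelsForest :
      ∀ {G : Graph n} {Y ts} →
      All (λ t → IsComponent G Y (verts t) × IsDecisionTree G (verts t) t) ts →
      AllPairs (λ A B → Empty (A ∩ B)) (map verts ts) → UniqueLabelsForest ts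
    IsDecisionTree⇒UniqueLabelsForest []                  []           = tt
    IsDecisionTree⇒UniqueLabelsForest {ts = t ∷ ts} ((_ , Dt) ∷ Dts) (t∩ts=∅ ∷ pairs) =
      IsDecisionTree⇒UniqueLabels Dt ,
      disjoint-vertsList ts t∩ts=∅ ,
      IsDecisionTree⇒UniqueLabelsForest Dts pairs
      where
      disjoint-vertsList : ∀ ss → All (λ B → Empty (verts t ∩ B)) (map verts ss) →
                           Disjoint (verts t) (vertsList ss)
      disjoint-vertsList []       []           x∈t x∈ss = ∉⊥ x∈ss
      disjoint-vertsList (s ∷ ss) (t∩s=∅ ∷ es) x∈t x∈ss with x∈p∪q⁻ (verts s) (vertsList ss) x∈ss
      ... | inj₁ x∈s   = t∩s=∅ (_ , x∈p∩q⁺ (x∈t , x∈s))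
      ... | inj₂ x∈ss′ = disjoint-vertsList ss es x∈t x∈ss′

  IsDecisionTreeG⇒∈verts : ∀ {G : Graph n} {t} → IsDecisionTreeG G t → ∀ x → x ∈ verts t
  IsDecisionTreeG⇒∈verts (mk {r = r} _ _ _ vertsList≡⊤-r) x with x FinP.≟ r
  ... | yes refl = x∈p∪q⁺ (inj₁ (x∈⁅x⁆ x))
  ... | no  x≢r  = x∈p∪q⁺ (inj₂ (subst (x ∈_) (sym vertsList≡⊤-r) (x∈p∧x≢y⇒x∈p-y ∈⊤ x≢r)))

module _ {n : ℕ} (G : Graph n) (c w : Fin n → ℕ) where

  cost≡sum-subtrees : ∀ D → UniqueLabels D → (∀ x → x ∈ verts D) →
                      cost G c w D ≡ sum (map (λ s → c (root s) * sumSet w (verts s)) (subtrees D))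
  cost≡sum-subtrees D uD covers = begin
    sum (map (λ x → w x * costAt G c w D x) (allFin n))
      ≡⟨ sum-map-cong (allFin n) (λ {x} _ → cong (w x *_) (sum-pathTo c x D uD (covers x))) ⟩
    sum (map (λ x → w x * rootCostContaining c x (subtrees D)) (allFin n))
      ≡⟨ sum-map-cong (allFin n) (λ {x} _ → sym (sum-map-*ˡ (subtrees D) (w x) (contribution x))) ⟩
    sum (map (λ x → sum (map (λ s → w x * contribution x s) (subtrees D))) (allFin n))
      ≡⟨ sum-map-comm (allFin n) (subtrees D) (λ x s → w x * contribution x s) ⟩
    sum (map (λ s → sum (map (λ x → w x * contribution x s) (allFin n))) (subtrees D))
      ≡⟨ sum-map-cong (subtrees D) (λ {s} _ → sum-contribution s) ⟩
    sum (map (λ s → c (root s) * sumSet w (verts s)) (subtrees D)) ∎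
    where
    contribution : Fin n → DTree n → ℕ
    contribution x s = c (root s) when does (x ∈? verts s)

    sum-contribution : ∀ s → sum (map (λ x → w x * contribution x s) (allFin n)) ≡
                             c (root s) * sumSet w (verts s)
    sum-contribution s =
      trans (sum-map-cong (allFin n) (λ {x} _ → *-when-comm (w x) (c (root s)) _))
            (sum-map-*ˡ (allFin n) (c (root s)) (w ↾ verts s))

  ∈⋃L⇔ : ∀ D k {x} → x ∈ ⋃ (L G c w D k) ⇔ (∃[ H ] H ∈L R G c w D × sumSet w H ≤ k × x ∈ H)
  ∈⋃L⇔ D k {x} = mk⇔ to from
    where
    to : x ∈ ⋃ (L G c w D k) → ∃[ H ] H ∈L R G c w D × sumSet w H ≤ k × x ∈ H
    to x∈⋃ with x∈⋃⁻ (L G c w D k) x∈⋃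
    ... | H , H∈L , x∈H with LMP.∈-filter⁻ (maximal? G c w D k) H∈L
    ...   | H∈R , wH≤k , _ = H , H∈R , wH≤k , x∈H

    from : ∃[ H ] H ∈L R G c w D × sumSet w H ≤ k × x ∈ H → x ∈ ⋃ (L G c w D k)
    from (H , H∈R , wH≤k , x∈H)
      with ∃-maximal (λ H → (sumSet w H ≤? k) ×-dec (x ∈? H)) (R G c w D) H∈R (wH≤k , x∈H)
    ... | M , M∈R , (wM≤k , x∈M) , M-maximal =
      x∈⋃⁺ (L G c w D k)
           (LMP.∈-filter⁺ (maximal? G c w D k) M∈R (wM≤k , All.tabulate M-maximal′)) x∈M
      where
      M-maximal′ : ∀ {H′} → H′ ∈L R G c w D → sumSet w H′ ≤ k → M ⊆ H′ → H′ ≡ M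
      M-maximal′ H′∈R wH′≤k M⊆H′ = M-maximal H′∈R (wH′≤k , M⊆H′ x∈M) M⊆H′

  root∈⋃L⇔ : ∀ D k → UniqueLabels D → ∀ {s} → s ∈L subtrees D →
             root s ∈ ⋃ (L G c w D k) ⇔ sumSet w (verts s) ≤ k
  root∈⋃L⇔ D k uD {s} s∈D = mk⇔ to from
    where
    to : root s ∈ ⋃ (L G c w D k) → sumSet w (verts s) ≤ k
    to rs∈⋃ with Equivalence.to (∈⋃L⇔ D k) rs∈⋃
    ... | H , H∈R , wH≤k , rs∈H with LMP.∈-map⁻ verts H∈R
    ...   | s′ , s′∈D , refl = ≤-trans (sumSet-mono w (subtrees-laminar D uD s∈D s′∈D rs∈H)) wH≤k

    from : sumSet w (verts s) ≤ k → root s ∈ ⋃ (L G c w D k)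
    from ws≤k = Equivalence.from (∈⋃L⇔ D k) (verts s , LMP.∈-map⁺ verts s∈D , ws≤k , root∈verts s)

  root∈S⇔ : ∀ D k → UniqueLabels D → ∀ {s} → s ∈L subtrees D →
            root s ∈ S G c w D k ⇔ k < sumSet w (verts s)
  root∈S⇔ D k uD s∈D = mk⇔
    (λ rs∈S → ≰⇒> (x∈∁p⇒x∉p rs∈S ∘ Equivalence.from (root∈⋃L⇔ D k uD s∈D)))
    (λ k<ws → x∉p⇒x∈∁p (<⇒≱ k<ws ∘ Equivalence.to (root∈⋃L⇔ D k uD s∈D)))

  sumSet-S : ∀ D k → UniqueLabels D → (∀ x → x ∈ verts D) →
             sumSet c (S G c w D k) ≡
             sum (map (λ s → c (root s) when does (k <? sumSet w (verts s))) (subtrees D))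
  sumSet-S D k uD covers = begin
    sumSet c (S G c w D k)
      ≡⟨ sumSet-full (c ↾ S G c w D k) covers ⟨
    sumSet (c ↾ S G c w D k) (verts D)
      ≡⟨ sum-map-root D uD (c ↾ S G c w D k) ⟨
    sum (map ((c ↾ S G c w D k) ∘ root) (subtrees D))
      ≡⟨ sum-map-cong (subtrees D) (λ {s} s∈D → cong (c (root s) when_)
           (does-⇔ (root∈S⇔ D k uD s∈D) (root s ∈? S G c w D k) (k <? sumSet w (verts s)))) ⟩
    sum (map (λ s → c (root s) when does (k <? sumSet w (verts s))) (subtrees D)) ∎

  sum-sumSet-S≡sum-subtrees :
    ∀ D → UniqueLabels D → (∀ x → x ∈ verts D) →
    sum (map (λ k → sumSet c (S G c w D k)) (upTo (sumSet w ⊤))) ≡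
    sum (map (λ s → c (root s) * sumSet w (verts s)) (subtrees D))
  sum-sumSet-S≡sum-subtrees D uD covers = begin
    sum (map (λ k → sumSet c (S G c w D k)) (upTo W))
      ≡⟨ sum-map-cong (upTo W) (λ {k} _ → sumSet-S D k uD covers) ⟩
    sum (map (λ k → sum (map (λ s → level k s) (subtrees D))) (upTo W))
      ≡⟨ sum-map-comm (upTo W) (subtrees D) level ⟩
    sum (map (λ s → sum (map (λ k → level k s) (upTo W))) (subtrees D))
      ≡⟨ sum-map-cong (subtrees D) (λ {s} _ → sum-levels s) ⟩
    sum (map (λ s → c (root s) * sumSet w (verts s)) (subtrees D)) ∎
    where
    W : ℕ
    W = sumSet w ⊤

    level : ℕ → DTree n → ℕ
    level k s = c (root s) when does (k <? sumSet w (verts s))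

    sum-levels : ∀ s → sum (map (λ k → level k s) (upTo W)) ≡ c (root s) * sumSet w (verts s)
    sum-levels s = trans (sum-upTo-when-< (c (root s)) (sumSet w (verts s)) W)
                         (cong (c (root s) *_) (m≥n⇒m⊓n≡n (sumSet-mono w (λ _ → ∈⊤))))

mainTheorem11 : ∀ {n} (G : Graph n) → Connected G →
    (c w : Fin n → ℕ) → (Dstar : DTree n) → IsOptimal G c w Dstar →
    cost G c w Dstar ≡ sum (map (λ k → sumSet c (S G c w Dstar k)) (upTo (sumSet w ⊤)))
mainTheorem11 G _ c w D (D-decisionTree , _) = begin
  cost G c w D
    ≡⟨ cost≡sum-subtrees G c w D uD covers ⟩
  sum (map (λ s → c (root s) * sumSet w (verts s)) (subtrees D))
    ≡⟨ sum-sumSet-S≡sum-subtrees G c w D uD covers ⟨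
  sum (map (λ k → sumSet c (S G c w D k)) (upTo (sumSet w ⊤))) ∎
  where
  uD : UniqueLabels D
  uD = IsDecisionTree⇒UniqueLabels D-decisionTree

  covers : ∀ x → x ∈ verts D
  covers = IsDecisionTreeG⇒∈verts D-decisionTree
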